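{- Let $\Gamma_i$ denote the degree (with multiplicity) of test $a_i$ in $\mathbf G$, and let $\mathcal G$ be the $\sigma$-algebra generated by $(\Gamma_i)_{i\in[m]}$. Let $(\mathbf X_i)_{i\in[m]}$ be, given $\mathcal G$, mutually independent random variables with $\mathbf X_i\sim\mathrm{Bin}(\Gamma_i,k/n)$, and let $\mathcal E=\{\sum_{i\in[m]}\mathbf X_i=k\Delta\}$. Let $\mathbf Y_i$ be the number of edges joining test $a_i$ to an infected individual. Then, given $\mathcal G$, the vector $(\mathbf Y_1,\dots,\mathbf Y_m)$ and the vector $(\mathbf X_1,\dots,\mathbf X_m)$ conditioned on $\mathcal E$ are identically distributed.
   Context: Group testing model: $\mathbf G=\mathbf G(n,m,\Delta)$ is the random bipartite multigraph on individuals $V=\{x_1,\dots,x_n\}$ and tests $a_1,\dots,a_m$ in which independently each individual chooses $\Delta$ tests uniformly at random with replacement and is joined to each by an edge (multi-edges possible), so that $\sum_i\Gamma_i=n\Delta$. $\boldsymbol\sigma\in\{0,1\}^V$ is uniform among vectors of Hamming weight $k$, independent of $\mathbf G$; $x$ is infected iff $\boldsymbol\sigma_x=1$. -}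

module Defs where

open import Data.Bool using (Bool; true; false; if_then_else_; _∧_)
open import Data.Nat using (ℕ; zero; suc; _+_; _*_; _∸_; _≡ᵇ_)
open import Data.Nat.Combinatorics using (_C_)
open import Data.Fin using (Fin)
open import Data.Fin.Properties using () renaming (_≟_ to _≟ᶠ_)
open import Data.Vec using (Vec; []; _∷_; lookup; toList)
open import Data.Vec.Properties using (≡-dec)
open import Data.List using (List; []; _∷_; concatMap; map; filter; length; allFin)
import Data.List as L
open import Data.Integer using (+_)
open import Data.Rational using (ℚ; 0ℚ; 1ℚ; _/_; _-_)
import Data.Rational as Q
import Data.Nat as N
open import Relation.Nullary.Decidable using (⌊_⌋)

-- rational a / d (with the convention a / 0 = 0; only used with d > 0
-- or where the quotient is irrelevant)
frac : ℕ → ℕ → ℚ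
frac a zero    = 0ℚ
frac a (suc d) = (+ a) / suc d

_^ℚ_ : ℚ → ℕ → ℚ
p ^ℚ zero  = 1ℚ
p ^ℚ suc e = p Q.* (p ^ℚ e)

sumℚ : List ℚ → ℚ
sumℚ = L.foldr Q._+_ 0ℚ

count : ∀ {A : Set} → (A → Bool) → List A → ℕ
count P []       = 0
count P (x ∷ xs) = (if P x then 1 else 0) + count P xs

uniformProb : ∀ {A : Set} → List A → (A → Bool) → ℚ
uniformProb Ω P = frac (count P Ω) (length Ω)

allVec : ∀ {A : Set} (k : ℕ) → List A → List (Vec A k)
allVec zero    xs = [] ∷ []
allVec (suc k) xs = concatMap (λ x → map (x ∷_) (allVec k xs)) xs

-- A realisation of G: individual x_j chooses its Δ tests (with replacement)
Graph : ℕ → ℕ → ℕ → Set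
Graph n m Δ = Vec (Vec (Fin m) Δ) n

-- sample space of G (uniform measure = each individual picks Δ tests
-- independently uniformly at random with replacement)
allGraphs : (n m Δ : ℕ) → List (Graph n m Δ)
allGraphs n m Δ = allVec n (allVec Δ (allFin m))

weight : ∀ {n} → Vec Bool n → ℕ
weight []           = 0
weight (true  ∷ s)  = suc (weight s)
weight (false ∷ s)  = weight s

allSigmas : (n k : ℕ) → List (Vec Bool n)
allSigmas n k = filter (λ s → weight s N.≟ k) (allVec n (true ∷ false ∷ []))

record Sample (n m Δ : ℕ) : Set where
  constructor _,_
  field
    graph : Graph n m Δ
    sigma : Vec Bool n

allSamples : (n m Δ k : ℕ) → List (Sample n m Δ)
allSamples n m Δ k =
  concatMap (λ G → map (G ,_) (allSigmas n k)) (allGraphs n m Δ)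

edgesTo : ∀ {n m Δ} → Fin m → Graph n m Δ → Vec Bool n → ℕ
edgesTo i []       []       = 0
edgesTo i (e ∷ G)  (b ∷ s)  =
  (if b then count (λ a → ⌊ a ≟ᶠ i ⌋) (toList e) else 0) + edgesTo i G s

allTrue : (n : ℕ) → Vec Bool n
allTrue zero    = []
allTrue (suc n) = true ∷ allTrue n

degree : ∀ {n m Δ} → Graph n m Δ → Fin m → ℕ
degree {n} G i = edgesTo i G (allTrue n)

degreeVec : ∀ {n m Δ} → Graph n m Δ → Vec ℕ m
degreeVec G = Data.Vec.tabulate (degree G)

Yvec : ∀ {n m Δ} → Sample n m Δ → Vec ℕ m
Yvec (G , s) = Data.Vec.tabulate (λ i → edgesTo i G s)

_≟ᵛ_ : ∀ {m} (u v : Vec ℕ m) → Bool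
u ≟ᵛ v = ⌊ ≡-dec N._≟_ u v ⌋

binPmf : ℕ → ℚ → ℕ → ℚ
binPmf N p x = (frac (N C x) 1) Q.* ((p ^ℚ x) Q.* ((1ℚ - p) ^ℚ (N ∸ x)))

upTo : ℕ → List ℕ
upTo N = L.upTo (suc N)   -- 0, 1, ..., N

-- all vectors y with 0 ≤ y_i ≤ g_i  (the support of X given Γ = g)
box : ∀ {m} → Vec ℕ m → List (Vec ℕ m)
box []      = [] ∷ []
box (g ∷ gs) = concatMap (λ x → map (x ∷_) (box gs)) (upTo g)

prodPmf : ∀ {m} → Vec ℕ m → ℚ → Vec ℕ m → ℚ
prodPmf []       p []       = 1ℚ
prodPmf (g ∷ gs) p (y ∷ ys) = binPmf g p y Q.* prodPmf gs p ys

probX : ∀ {m} → Vec ℕ m → ℚ → (Vec ℕ m → Bool) → ℚ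
probX g p Q = sumℚ (map (prodPmf g p) (filter (λ y → Q y Data.Bool.≟ true) (box g)))

vsum : ∀ {m} → Vec ℕ m → ℕ
vsum []       = 0
vsum (y ∷ ys) = y + vsum ys

eventE : ∀ {m} → ℕ → ℕ → Vec ℕ m → Bool
eventE k Δ y = vsum y ≡ᵇ (k * Δ)

-- elementary conditional probability P(A | B) = P(A ∩ B) / P(B)
-- (set to 0 when P(B) = 0; only used under the hypothesis P(B) ≠ 0)
condℚ : ℚ → ℚ → ℚ
condℚ a (Q.mkℚ (+ 0) _ _) = 0ℚ
condℚ a b@(Q.mkℚ Data.Integer.+[1+ _ ] _ _) = a Q.÷ b
condℚ a b@(Q.mkℚ Data.Integer.-[1+ _ ] _ _) = a Q.÷ b

probGS : (n m Δ k : ℕ) → (Sample n m Δ → Bool) → ℚ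
probGS n m Δ k P = uniformProb (allSamples n m Δ k) P

module Submission where

-- Fix the infected set σ, of size k. Listing the Δ test choices of every individual in order,
-- a graph is a uniform word of length nΔ over the alphabet of tests; Y counts the letters coming
-- from infected individuals (a word of length kΔ) and Γ all letters. For y ≤ g the number of
-- graphs with Y = y and Γ = g is the product of multinomial coefficients
-- (kΔ; y) ((n - k)Δ; g - y) = (kΔ)! ((n - k)Δ)! ∏ C(g_i, y_i) / ∏ g_i!, while for Σ g = nΔ and
-- Σ y = kΔ we have P(X = y | Γ = g) = ∏ C(g_i, y_i) p^{kΔ} (1 - p)^{(n - k)Δ}. So both
-- conditional laws are proportional to ∏ C(g_i, y_i) on {y ≤ g, Σ y = kΔ}, hence equal.

open import Defs
open import Data.Bool using (Bool; true; false; if_then_else_; _∧_)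
import Data.Bool as Bool
open import Data.Bool.Properties using (∧-comm; ∧-conicalˡ; ∧-conicalʳ; T-≡)
open import Data.Empty using (⊥-elim)
open import Data.Fin using (Fin; zero; suc)
open import Data.Fin.Properties using () renaming (_≟_ to _≟ᶠ_)
open import Data.Integer using (+[1+_]; -[1+_])
import Data.Integer as ℤ
import Data.Integer.Properties as ℤ
open import Data.List using (List; []; _∷_; map; concatMap; _++_; filter; length; allFin)
import Data.List as List
open import Data.List.Properties using (map-tabulate; map-upTo)
open import Data.List.Relation.Unary.All using (All; []; _∷_)
import Data.List.Relation.Unary.All as All
open import Data.List.Relation.Unary.All.Properties using (all-filter; filter⁺; concat⁺; map⁺; applyUpTo⁺₁)
open import Data.Nat using (ℕ; zero; suc; _+_; _*_; _∸_; _≤_; _<_; s≤s; _≡ᵇ_; _≤ᵇ_; _<ᵇ_; _!; pred; NonZero; ≢-nonZero; ≢-nonZero⁻¹)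
open import Data.Nat.Combinatorics using (_C_; nCk≡n!/k![n-k]!; k![n∸k]!∣n!)
open import Data.Nat.DivMod using (m/n*n≡m)
open import Data.Nat.Properties
open import Algebra.Properties.CommutativeSemigroup +-commutativeSemigroup using ()
  renaming (interchange to +-interchange)
open import Algebra.Properties.CommutativeSemigroup *-commutativeSemigroup using ()
  renaming (interchange to *-interchange; x∙yz≈y∙xz to *-left-comm)
open import Data.Nat.Tactic.RingSolver using (solve-∀)
open import Data.Product using (_,_)
open import Data.Rational using (ℚ; mkℚ; 0ℚ; 1ℚ; _-_; _÷_; 1/_; toℚᵘ; Positive)
  renaming (_+_ to _+ℚ_; _*_ to _*ℚ_)
import Data.Rational as ℚ
import Data.Rational.Properties as ℚ
open import Data.Rational.Solver using (module +-*-Solver)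
open import Data.Rational.Unnormalised using (mkℚᵘ; *≡*)
import Data.Rational.Unnormalised as ℚᵘ
import Data.Rational.Unnormalised.Properties as ℚᵘ
open import Data.Vec using (Vec; []; _∷_; lookup; tabulate; toList; replicate; zipWith; _[_]≔_; _[_]%=_)
open import Data.Vec.Properties using (≡-dec; tabulate-cong; zipWith-identityˡ; zipWith-assoc; zipWith-comm)
open import Function.Bundles using (Equivalence)
open import Relation.Binary.PropositionalEquality
open import Relation.Nullary.Decidable using (Dec; ⌊_⌋; yes; no)

𝟙 : Bool → ℕ
𝟙 b = if b then 1 else 0

𝟙-∧ : ∀ a b → 𝟙 (a ∧ b) ≡ 𝟙 a * 𝟙 b
𝟙-∧ true  b = sym (+-identityʳ (𝟙 b))
𝟙-∧ false b = refl

∑ : {A : Set} → List A → (A → ℕ) → ℕ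
∑ []       f = 0
∑ (x ∷ xs) f = f x + ∑ xs f

syntax ∑ xs (λ x → e) = ∑[ x ← xs ] e

module _ {A : Set} where

  ∑-cong-All : ∀ {P : A → Set} {f g : A → ℕ} (xs : List A) → All P xs →
            (∀ x → P x → f x ≡ g x) → ∑ xs f ≡ ∑ xs g
  ∑-cong-All []       []       eq = refl
  ∑-cong-All (x ∷ xs) (p ∷ ps) eq = cong₂ _+_ (eq x p) (∑-cong-All xs ps eq)

  ∑-cong : ∀ {f g : A → ℕ} (xs : List A) → (∀ x → f x ≡ g x) → ∑ xs f ≡ ∑ xs g
  ∑-cong []       eq = refl
  ∑-cong (x ∷ xs) eq = cong₂ _+_ (eq x) (∑-cong xs eq)

  ∑-zero : ∀ (xs : List A) → ∑[ _ ← xs ] 0 ≡ 0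
  ∑-zero []       = refl
  ∑-zero (x ∷ xs) = ∑-zero xs

  ∑-++ : ∀ (xs ys : List A) f → ∑ (xs ++ ys) f ≡ ∑ xs f + ∑ ys f
  ∑-++ []       ys f = refl
  ∑-++ (x ∷ xs) ys f = trans (cong (f x +_) (∑-++ xs ys f)) (sym (+-assoc (f x) _ _))

  ∑-distrib-+ : ∀ (xs : List A) f g → ∑[ x ← xs ] (f x + g x) ≡ ∑ xs f + ∑ xs g
  ∑-distrib-+ []       f g = refl
  ∑-distrib-+ (x ∷ xs) f g rewrite ∑-distrib-+ xs f g = +-interchange (f x) (g x) (∑ xs f) (∑ xs g)

  *-distribˡ-∑ : ∀ (xs : List A) c f → ∑[ x ← xs ] (c * f x) ≡ c * ∑ xs f
  *-distribˡ-∑ []       c f = sym (*-zeroʳ c)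
  *-distribˡ-∑ (x ∷ xs) c f rewrite *-distribˡ-∑ xs c f = sym (*-distribˡ-+ c (f x) (∑ xs f))

  *-distribʳ-∑ : ∀ (xs : List A) c f → ∑[ x ← xs ] (f x * c) ≡ ∑ xs f * c
  *-distribʳ-∑ []       c f = refl
  *-distribʳ-∑ (x ∷ xs) c f rewrite *-distribʳ-∑ xs c f = sym (*-distribʳ-+ c (f x) (∑ xs f))

  ∑-const : ∀ (xs : List A) c → ∑[ _ ← xs ] c ≡ length xs * c
  ∑-const []       c = refl
  ∑-const (x ∷ xs) c = cong (c +_) (∑-const xs c)

  ∑-filter : ∀ (Q : A → Bool) (xs : List A) (f : A → ℕ) →
             ∑ (filter (λ x → Q x Bool.≟ true) xs) f ≡ ∑[ x ← xs ] (𝟙 (Q x) * f x)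
  ∑-filter Q []       f = refl
  ∑-filter Q (x ∷ xs) f with Q x
  ... | true  = cong₂ _+_ (sym (+-identityʳ (f x))) (∑-filter Q xs f)
  ... | false = ∑-filter Q xs f

  count≡∑𝟙 : ∀ (P : A → Bool) xs → count P xs ≡ ∑[ x ← xs ] 𝟙 (P x)
  count≡∑𝟙 P []       = refl
  count≡∑𝟙 P (x ∷ xs) = cong (𝟙 (P x) +_) (count≡∑𝟙 P xs)

module _ {A B : Set} where

  ∑-map : ∀ (h : A → B) xs (f : B → ℕ) → ∑ (map h xs) f ≡ ∑[ x ← xs ] f (h x)
  ∑-map h []       f = refl
  ∑-map h (x ∷ xs) f = cong (f (h x) +_) (∑-map h xs f)

  ∑-concatMap : ∀ (h : A → List B) xs (f : B → ℕ) →
                ∑ (concatMap h xs) f ≡ ∑[ x ← xs ] ∑ (h x) f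
  ∑-concatMap h []       f = refl
  ∑-concatMap h (x ∷ xs) f =
    trans (∑-++ (h x) (concatMap h xs) f) (cong (∑ (h x) f +_) (∑-concatMap h xs f))

  ∑-comm : ∀ (xs : List A) (ys : List B) (f : A → B → ℕ) →
           ∑[ x ← xs ] ∑[ y ← ys ] f x y ≡ ∑[ y ← ys ] ∑[ x ← xs ] f x y
  ∑-comm []       ys f = sym (∑-zero ys)
  ∑-comm (x ∷ xs) ys f =
    trans (cong (∑ ys (f x) +_) (∑-comm xs ys f))
          (sym (∑-distrib-+ ys (f x) (λ y → ∑[ x ← xs ] f x y)))

∑-allVec-suc : ∀ {A : Set} n (xs : List A) (f : Vec A (suc n) → ℕ) →
               ∑ (allVec (suc n) xs) f ≡ ∑[ x ← xs ] ∑[ v ← allVec n xs ] f (x ∷ v)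
∑-allVec-suc n xs f =
  trans (∑-concatMap (λ x → map (x ∷_) (allVec n xs)) xs f)
        (∑-cong xs (λ x → ∑-map (x ∷_) (allVec n xs) f))

∑-allFin-suc : ∀ m (f : Fin (suc m) → ℕ) → ∑ (allFin (suc m)) f ≡ f zero + ∑[ i ← allFin m ] f (suc i)
∑-allFin-suc m f = cong (f zero +_)
  (trans (cong (λ is → ∑ is f) (sym (map-tabulate (λ i → i) suc))) (∑-map suc (allFin m) f))

∑-allFin-lookup : ∀ {m} (y : Vec ℕ m) → ∑ (allFin m) (lookup y) ≡ vsum y
∑-allFin-lookup []       = refl
∑-allFin-lookup {suc m} (a ∷ y) = trans (∑-allFin-suc m (lookup (a ∷ y))) (cong (a +_) (∑-allFin-lookup y))

infixl 6 _+ᵥ_ _∸ᵥ_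
infix  4 _≡ᵇᵛ_ _≤ᵇᵛ_

0ᵥ : ∀ {m} → Vec ℕ m
0ᵥ = replicate _ 0

_+ᵥ_ _∸ᵥ_ : ∀ {m} → Vec ℕ m → Vec ℕ m → Vec ℕ m
_+ᵥ_ = zipWith _+_
_∸ᵥ_ = zipWith _∸_

unit : ∀ {m} → Fin m → Vec ℕ m
unit i = 0ᵥ [ i ]≔ 1

-- a structural version of _≟ᵛ_, which computes on _∷_
_≡ᵇᵛ_ : ∀ {m} → Vec ℕ m → Vec ℕ m → Bool
[]      ≡ᵇᵛ []      = true
(a ∷ u) ≡ᵇᵛ (b ∷ v) = (a ≡ᵇ b) ∧ (u ≡ᵇᵛ v)

_≤ᵇᵛ_ : ∀ {m} → Vec ℕ m → Vec ℕ m → Bool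
[]      ≤ᵇᵛ []      = true
(a ∷ u) ≤ᵇᵛ (b ∷ v) = (a ≤ᵇ b) ∧ (u ≤ᵇᵛ v)

∏! : ∀ {m} → Vec ℕ m → ℕ
∏! []      = 1
∏! (a ∷ y) = a ! * ∏! y

∏C : ∀ {m} → Vec ℕ m → Vec ℕ m → ℕ
∏C []      []      = 1
∏C (a ∷ g) (b ∷ y) = (a C b) * ∏C g y

≡ᵇ-true⇒≡ : ∀ a b → (a ≡ᵇ b) ≡ true → a ≡ b
≡ᵇ-true⇒≡ a b e = ≡ᵇ⇒≡ a b (Equivalence.from T-≡ e)

≤ᵇ-true⇒≤ : ∀ a b → (a ≤ᵇ b) ≡ true → a ≤ b
≤ᵇ-true⇒≤ a b e = ≤ᵇ⇒≤ a b (Equivalence.from T-≡ e)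

≤⇒≤ᵇ≡true : ∀ {a b} → a ≤ b → (a ≤ᵇ b) ≡ true
≤⇒≤ᵇ≡true a≤b = Equivalence.to T-≡ (≤⇒≤ᵇ a≤b)

≡ᵇ-refl : ∀ a → (a ≡ᵇ a) ≡ true
≡ᵇ-refl zero    = refl
≡ᵇ-refl (suc a) = ≡ᵇ-refl a

≡ᵇ-comm : ∀ a b → (a ≡ᵇ b) ≡ (b ≡ᵇ a)
≡ᵇ-comm zero    zero    = refl
≡ᵇ-comm zero    (suc b) = refl
≡ᵇ-comm (suc a) zero    = refl
≡ᵇ-comm (suc a) (suc b) = ≡ᵇ-comm a b

≡ᵇᵛ-true⇒≡ : ∀ {m} {u v : Vec ℕ m} → (u ≡ᵇᵛ v) ≡ true → u ≡ v
≡ᵇᵛ-true⇒≡ {u = []}    {[]}    e = refl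
≡ᵇᵛ-true⇒≡ {u = a ∷ u} {b ∷ v} e =
  cong₂ _∷_ (≡ᵇ-true⇒≡ a b (∧-conicalˡ _ _ e)) (≡ᵇᵛ-true⇒≡ (∧-conicalʳ (a ≡ᵇ b) _ e))

≡ᵇᵛ-refl : ∀ {m} (u : Vec ℕ m) → (u ≡ᵇᵛ u) ≡ true
≡ᵇᵛ-refl []      = refl
≡ᵇᵛ-refl (a ∷ u) rewrite ≡ᵇ-refl a = ≡ᵇᵛ-refl u

≡ᵇᵛ-comm : ∀ {m} (u v : Vec ℕ m) → (u ≡ᵇᵛ v) ≡ (v ≡ᵇᵛ u)
≡ᵇᵛ-comm []      []      = refl
≡ᵇᵛ-comm (a ∷ u) (b ∷ v) = cong₂ _∧_ (≡ᵇ-comm a b) (≡ᵇᵛ-comm u v)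

≟ᵛ≡≡ᵇᵛ : ∀ {m} (u v : Vec ℕ m) → (u ≟ᵛ v) ≡ (u ≡ᵇᵛ v)
≟ᵛ≡≡ᵇᵛ u v with ≡-dec _≟_ u v
... | yes refl = sym (≡ᵇᵛ-refl u)
... | no u≢v with u ≡ᵇᵛ v in e
...   | true  = ⊥-elim (u≢v (≡ᵇᵛ-true⇒≡ e))
...   | false = refl

𝟙-≡ᵇᵛ-subst : ∀ {m} (y : Vec ℕ m) (f : Vec ℕ m → ℕ) x → 𝟙 (x ≡ᵇᵛ y) * f x ≡ 𝟙 (x ≡ᵇᵛ y) * f y
𝟙-≡ᵇᵛ-subst y f x with x ≡ᵇᵛ y in e
... | true  = cong (λ z → 1 * f z) (≡ᵇᵛ-true⇒≡ e)
... | false = refl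

0ᵥ-+ᵥ : ∀ {m} (c : Vec ℕ m) → 0ᵥ +ᵥ c ≡ c
0ᵥ-+ᵥ = zipWith-identityˡ +-identityˡ

+ᵥ-assoc : ∀ {m} (a b c : Vec ℕ m) → a +ᵥ b +ᵥ c ≡ a +ᵥ (b +ᵥ c)
+ᵥ-assoc = zipWith-assoc +-assoc

+ᵥ-comm : ∀ {m} (a b : Vec ℕ m) → a +ᵥ b ≡ b +ᵥ a
+ᵥ-comm = zipWith-comm +-comm

tabulate-+ : ∀ {m} (f g : Fin m → ℕ) → tabulate (λ i → f i + g i) ≡ tabulate f +ᵥ tabulate g
tabulate-+ {zero}  f g = refl
tabulate-+ {suc m} f g = cong (f zero + g zero ∷_) (tabulate-+ (λ i → f (suc i)) (λ i → g (suc i)))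

tabulate-0 : ∀ {m} → tabulate {n = m} (λ _ → 0) ≡ 0ᵥ
tabulate-0 {zero}  = refl
tabulate-0 {suc m} = cong (0 ∷_) tabulate-0

𝟙-≡ᵇᵛ-unit+ : ∀ {m} (i : Fin m) (c y : Vec ℕ m) →
  𝟙 (unit i +ᵥ c ≡ᵇᵛ y) ≡ 𝟙 (0 <ᵇ lookup y i) * 𝟙 (c ≡ᵇᵛ y [ i ]%= pred)
𝟙-≡ᵇᵛ-unit+ zero    (c ∷ cs) (zero  ∷ y) = refl
𝟙-≡ᵇᵛ-unit+ zero    (c ∷ cs) (suc b ∷ y) rewrite 0ᵥ-+ᵥ cs = sym (+-identityʳ _)
𝟙-≡ᵇᵛ-unit+ (suc i) (c ∷ cs) (b ∷ y) = begin
  𝟙 ((c ≡ᵇ b) ∧ (unit i +ᵥ cs ≡ᵇᵛ y))                            ≡⟨ 𝟙-∧ (c ≡ᵇ b) _ ⟩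
  𝟙 (c ≡ᵇ b) * 𝟙 (unit i +ᵥ cs ≡ᵇᵛ y)                            ≡⟨ cong (𝟙 (c ≡ᵇ b) *_) (𝟙-≡ᵇᵛ-unit+ i cs y) ⟩
  𝟙 (c ≡ᵇ b) * (𝟙 (0 <ᵇ lookup y i) * 𝟙 (cs ≡ᵇᵛ y [ i ]%= pred)) ≡⟨ *-left-comm (𝟙 (c ≡ᵇ b)) (𝟙 (0 <ᵇ lookup y i)) _ ⟩
  𝟙 (0 <ᵇ lookup y i) * (𝟙 (c ≡ᵇ b) * 𝟙 (cs ≡ᵇᵛ y [ i ]%= pred)) ≡⟨ cong (𝟙 (0 <ᵇ lookup y i) *_) (𝟙-∧ (c ≡ᵇ b) _) ⟨
  𝟙 (0 <ᵇ lookup y i) * 𝟙 ((c ≡ᵇ b) ∧ (cs ≡ᵇᵛ y [ i ]%= pred))   ∎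
  where open ≡-Reasoning

𝟙-0ᵥ≡ᵇᵛ-* : ∀ {m} (y : Vec ℕ m) → 𝟙 (0ᵥ ≡ᵇᵛ y) * ∏! y ≡ 𝟙 (vsum y ≡ᵇ 0)
𝟙-0ᵥ≡ᵇᵛ-* []          = refl
𝟙-0ᵥ≡ᵇᵛ-* (zero  ∷ y) = trans (cong (𝟙 (0ᵥ ≡ᵇᵛ y) *_) (+-identityʳ (∏! y))) (𝟙-0ᵥ≡ᵇᵛ-* y)
𝟙-0ᵥ≡ᵇᵛ-* (suc a ∷ y) = refl

𝟙-+≡ᵇ : ∀ a b g → 𝟙 (a + b ≡ᵇ g) ≡ 𝟙 (a ≤ᵇ g) * 𝟙 (b ≡ᵇ g ∸ a)
𝟙-+≡ᵇ zero          b g       = sym (+-identityʳ _)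
𝟙-+≡ᵇ (suc a)       b zero    = refl
𝟙-+≡ᵇ (suc zero)    b (suc g) = 𝟙-+≡ᵇ zero b g
𝟙-+≡ᵇ (suc (suc a)) b (suc g) = 𝟙-+≡ᵇ (suc a) b g

𝟙-+ᵥ≡ᵇᵛ : ∀ {m} (a b g : Vec ℕ m) → 𝟙 (a +ᵥ b ≡ᵇᵛ g) ≡ 𝟙 (a ≤ᵇᵛ g) * 𝟙 (b ≡ᵇᵛ g ∸ᵥ a)
𝟙-+ᵥ≡ᵇᵛ []      []      []      = refl
𝟙-+ᵥ≡ᵇᵛ (a ∷ u) (b ∷ v) (c ∷ g) = begin
  𝟙 ((a + b ≡ᵇ c) ∧ (u +ᵥ v ≡ᵇᵛ g))                                ≡⟨ 𝟙-∧ (a + b ≡ᵇ c) _ ⟩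
  𝟙 (a + b ≡ᵇ c) * 𝟙 (u +ᵥ v ≡ᵇᵛ g)                                ≡⟨ cong₂ _*_ (𝟙-+≡ᵇ a b c) (𝟙-+ᵥ≡ᵇᵛ u v g) ⟩
  (𝟙 (a ≤ᵇ c) * 𝟙 (b ≡ᵇ c ∸ a)) * (𝟙 (u ≤ᵇᵛ g) * 𝟙 (v ≡ᵇᵛ g ∸ᵥ u)) ≡⟨ *-interchange (𝟙 (a ≤ᵇ c)) _ _ _ ⟩
  (𝟙 (a ≤ᵇ c) * 𝟙 (u ≤ᵇᵛ g)) * (𝟙 (b ≡ᵇ c ∸ a) * 𝟙 (v ≡ᵇᵛ g ∸ᵥ u)) ≡⟨ cong₂ _*_ (𝟙-∧ (a ≤ᵇ c) _) (𝟙-∧ (b ≡ᵇ c ∸ a) _) ⟨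
  𝟙 ((a ≤ᵇ c) ∧ (u ≤ᵇᵛ g)) * 𝟙 ((b ≡ᵇ c ∸ a) ∧ (v ≡ᵇᵛ g ∸ᵥ u))     ∎
  where open ≡-Reasoning

∏!-nonZero : ∀ {m} (g : Vec ℕ m) → NonZero (∏! g)
∏!-nonZero []      = _
∏!-nonZero (a ∷ g) = m*n≢0 (a !) (∏! g) {{a !≢0}} {{∏!-nonZero g}}

∏!-decrement : ∀ {m} (i : Fin m) (y : Vec ℕ m) → (0 <ᵇ lookup y i) ≡ true →
               ∏! y ≡ lookup y i * ∏! (y [ i ]%= pred)
∏!-decrement zero    (suc a ∷ y) _ = *-assoc (suc a) (a !) (∏! y)
∏!-decrement (suc i) (a ∷ y)     e rewrite ∏!-decrement i y e = *-left-comm (a !) (lookup y i) _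

vsum-decrement : ∀ {m} (i : Fin m) (y : Vec ℕ m) → (0 <ᵇ lookup y i) ≡ true →
                 vsum y ≡ suc (vsum (y [ i ]%= pred))
vsum-decrement zero    (suc a ∷ y) _ = refl
vsum-decrement (suc i) (a ∷ y)     e rewrite vsum-decrement i y e = +-suc a _

n!≡nCk*[k!*[n∸k]!] : ∀ {n k} → k ≤ n → n ! ≡ (n C k) * (k ! * (n ∸ k) !)
n!≡nCk*[k!*[n∸k]!] {n} {k} k≤n =
  trans (sym (m/n*n≡m {{_}} (k![n∸k]!∣n! k≤n))) (cong (_* (k ! * (n ∸ k) !)) (sym (nCk≡n!/k![n-k]! k≤n)))

∏!-split : ∀ {m} (g y : Vec ℕ m) → (y ≤ᵇᵛ g) ≡ true → ∏! g ≡ ∏C g y * (∏! y * ∏! (g ∸ᵥ y))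
∏!-split []      []      _ = refl
∏!-split (a ∷ g) (b ∷ y) e =
  trans (cong₂ _*_ (n!≡nCk*[k!*[n∸k]!] (≤ᵇ-true⇒≤ b a (∧-conicalˡ (b ≤ᵇ a) _ e)))
                   (∏!-split g y (∧-conicalʳ (b ≤ᵇ a) _ e)))
        (interchange (a C b) (b !) ((a ∸ b) !) (∏C g y) (∏! y) (∏! (g ∸ᵥ y)))
  where
  interchange : ∀ p q r s t u → p * (q * r) * (s * (t * u)) ≡ p * s * (q * t * (r * u))
  interchange = solve-∀

vsum-∸ᵥ : ∀ {m} (g y : Vec ℕ m) → (y ≤ᵇᵛ g) ≡ true → vsum (g ∸ᵥ y) + vsum y ≡ vsum g
vsum-∸ᵥ []      []      _ = refl
vsum-∸ᵥ (a ∷ g) (b ∷ y) e =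
  trans (+-interchange (a ∸ b) (vsum (g ∸ᵥ y)) b (vsum y))
        (cong₂ _+_ (m∸n+n≡m (≤ᵇ-true⇒≤ b a (∧-conicalˡ (b ≤ᵇ a) _ e))) (vsum-∸ᵥ g y (∧-conicalʳ (b ≤ᵇ a) _ e)))

-- Words and multinomial coefficients

module _ {m : ℕ} where

  -- wordSum L h sums h over the letter-count vectors of the m ^ L words of length L (see ∑-words)
  wordSum : ℕ → (Vec ℕ m → ℕ) → ℕ
  wordSum zero    h = h 0ᵥ
  wordSum (suc L) h = ∑[ i ← allFin m ] wordSum L (λ c → h (unit i +ᵥ c))

  wordSum-cong : ∀ L {f g : Vec ℕ m → ℕ} → (∀ c → f c ≡ g c) → wordSum L f ≡ wordSum L g
  wordSum-cong zero    eq = eq 0ᵥ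
  wordSum-cong (suc L) eq = ∑-cong (allFin m) (λ i → wordSum-cong L (λ c → eq (unit i +ᵥ c)))

  wordSum-zero : ∀ L → wordSum L (λ _ → 0) ≡ 0
  wordSum-zero zero    = refl
  wordSum-zero (suc L) = trans (∑-cong (allFin m) (λ _ → wordSum-zero L)) (∑-zero (allFin m))

  wordSum-distrib-+ : ∀ L f g → wordSum L (λ c → f c + g c) ≡ wordSum L f + wordSum L g
  wordSum-distrib-+ zero    f g = refl
  wordSum-distrib-+ (suc L) f g =
    trans (∑-cong (allFin m) (λ i → wordSum-distrib-+ L (λ c → f (unit i +ᵥ c)) (λ c → g (unit i +ᵥ c))))
          (∑-distrib-+ (allFin m) _ _)

  *-distribʳ-wordSum : ∀ L k f → wordSum L (λ c → f c * k) ≡ wordSum L f * k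
  *-distribʳ-wordSum zero    k f = refl
  *-distribʳ-wordSum (suc L) k f =
    trans (∑-cong (allFin m) (λ i → *-distribʳ-wordSum L k (λ c → f (unit i +ᵥ c)))) (*-distribʳ-∑ (allFin m) k _)

  *-distribˡ-wordSum : ∀ L k f → wordSum L (λ c → k * f c) ≡ k * wordSum L f
  *-distribˡ-wordSum L k f =
    trans (wordSum-cong L (λ c → *-comm k (f c))) (trans (*-distribʳ-wordSum L k f) (*-comm (wordSum L f) k))

  wordSum-∑ : ∀ {A : Set} L (xs : List A) (f : A → Vec ℕ m → ℕ) →
              wordSum L (λ c → ∑[ x ← xs ] f x c) ≡ ∑[ x ← xs ] wordSum L (f x)
  wordSum-∑ L []       f = wordSum-zero L
  wordSum-∑ L (x ∷ xs) f =
    trans (wordSum-distrib-+ L (f x) (λ c → ∑[ x ← xs ] f x c)) (cong (wordSum L (f x) +_) (wordSum-∑ L xs f))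

  wordSum-comm : ∀ K L (F : Vec ℕ m → Vec ℕ m → ℕ) →
                 wordSum K (λ c → wordSum L (F c)) ≡ wordSum L (λ d → wordSum K (λ c → F c d))
  wordSum-comm zero    L F = refl
  wordSum-comm (suc K) L F =
    trans (∑-cong (allFin m) (λ i → wordSum-comm K L (λ c → F (unit i +ᵥ c))))
          (sym (wordSum-∑ L (allFin m) (λ i d → wordSum K (λ c → F (unit i +ᵥ c) d))))

  -- a word of length K + L is a word of length K followed by one of length L
  wordSum-+ : ∀ K L (h : Vec ℕ m → ℕ) → wordSum K (λ c → wordSum L (λ d → h (c +ᵥ d))) ≡ wordSum (K + L) h
  wordSum-+ zero    L h = wordSum-cong L (λ d → cong h (0ᵥ-+ᵥ d))
  wordSum-+ (suc K) L h = ∑-cong (allFin m) (λ i →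
    trans (wordSum-cong K (λ c → wordSum-cong L (λ d → cong h (+ᵥ-assoc (unit i) c d))))
          (wordSum-+ K L (λ c → h (unit i +ᵥ c))))

  wordSum-𝟙-≡ᵇᵛ : ∀ L (y : Vec ℕ m) (f : Vec ℕ m → ℕ) →
                  wordSum L (λ c → 𝟙 (c ≡ᵇᵛ y) * f c) ≡ wordSum L (λ c → 𝟙 (c ≡ᵇᵛ y)) * f y
  wordSum-𝟙-≡ᵇᵛ L y f = trans (wordSum-cong L (𝟙-≡ᵇᵛ-subst y f)) (*-distribʳ-wordSum L (f y) _)

  multinomial : ℕ → Vec ℕ m → ℕ
  multinomial L y = wordSum L (λ c → 𝟙 (c ≡ᵇᵛ y))

  multinomial-first-letter : ∀ L (y : Vec ℕ m) i →
    wordSum L (λ c → 𝟙 (unit i +ᵥ c ≡ᵇᵛ y)) ≡ 𝟙 (0 <ᵇ lookup y i) * multinomial L (y [ i ]%= pred)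
  multinomial-first-letter L y i = trans (wordSum-cong L (λ c → 𝟙-≡ᵇᵛ-unit+ i c y)) (*-distribˡ-wordSum L (𝟙 (0 <ᵇ lookup y i)) _)

  multinomial-*-∏! : ∀ L (y : Vec ℕ m) → multinomial L y * ∏! y ≡ 𝟙 (vsum y ≡ᵇ L) * L !
  multinomial-*-∏! zero    y = trans (𝟙-0ᵥ≡ᵇᵛ-* y) (sym (*-identityʳ _))
  multinomial-*-∏! (suc L) y = begin
    ∑[ i ← allFin m ] wordSum L (λ c → 𝟙 (unit i +ᵥ c ≡ᵇᵛ y)) * ∏! y   ≡⟨ *-distribʳ-∑ (allFin m) (∏! y) _ ⟨
    ∑[ i ← allFin m ] (wordSum L (λ c → 𝟙 (unit i +ᵥ c ≡ᵇᵛ y)) * ∏! y) ≡⟨ ∑-cong (allFin m) step ⟩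
    ∑[ i ← allFin m ] (lookup y i * (𝟙 (vsum y ≡ᵇ suc L) * L !))       ≡⟨ *-distribʳ-∑ (allFin m) _ (lookup y) ⟩
    ∑ (allFin m) (lookup y) * (𝟙 (vsum y ≡ᵇ suc L) * L !)              ≡⟨ cong (_* (𝟙 (vsum y ≡ᵇ suc L) * L !)) (∑-allFin-lookup y) ⟩
    vsum y * (𝟙 (vsum y ≡ᵇ suc L) * L !)                               ≡⟨ vsum-absorb ⟩
    𝟙 (vsum y ≡ᵇ suc L) * suc L !                                      ∎
    where
    open ≡-Reasoning
    vsum-absorb : vsum y * (𝟙 (vsum y ≡ᵇ suc L) * L !) ≡ 𝟙 (vsum y ≡ᵇ suc L) * suc L !
    vsum-absorb with vsum y ≡ᵇ suc L in e
    ... | true  rewrite ≡ᵇ-true⇒≡ (vsum y) (suc L) e = trans (cong (suc L *_) (+-identityʳ (L !))) (sym (+-identityʳ _))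
    ... | false = *-zeroʳ (vsum y)
    step : ∀ i → wordSum L (λ c → 𝟙 (unit i +ᵥ c ≡ᵇᵛ y)) * ∏! y ≡ lookup y i * (𝟙 (vsum y ≡ᵇ suc L) * L !)
    step i = trans (cong (_* ∏! y) (multinomial-first-letter L y i)) first-letter-*
      where
      y′ : Vec ℕ m
      y′ = y [ i ]%= pred
      first-letter-* : 𝟙 (0 <ᵇ lookup y i) * multinomial L y′ * ∏! y ≡ lookup y i * (𝟙 (vsum y ≡ᵇ suc L) * L !)
      first-letter-* with 0 <ᵇ lookup y i in e
      ... | false = sym (cong (_* (𝟙 (vsum y ≡ᵇ suc L) * L !)) (lookup≡0 {lookup y i} e))
        where
        lookup≡0 : ∀ {a} → (0 <ᵇ a) ≡ false → a ≡ 0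
        lookup≡0 {zero} _ = refl
      ... | true = begin
        1 * multinomial L y′ * ∏! y              ≡⟨ cong (_* ∏! y) (*-identityˡ (multinomial L y′)) ⟩
        multinomial L y′ * ∏! y                  ≡⟨ cong (multinomial L y′ *_) (∏!-decrement i y e) ⟩
        multinomial L y′ * (lookup y i * ∏! y′)  ≡⟨ *-left-comm (multinomial L y′) (lookup y i) (∏! y′) ⟩
        lookup y i * (multinomial L y′ * ∏! y′)  ≡⟨ cong (lookup y i *_) (multinomial-*-∏! L y′) ⟩
        lookup y i * (𝟙 (vsum y′ ≡ᵇ L) * L !)    ≡⟨ cong (λ v → lookup y i * (𝟙 (v ≡ᵇ suc L) * L !)) (vsum-decrement i y e) ⟨
        lookup y i * (𝟙 (vsum y ≡ᵇ suc L) * L !) ∎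

-- Graphs as words

letterCounts : ∀ {m L} → Vec (Fin m) L → Vec ℕ m
letterCounts e = tabulate (λ i → count (λ a → ⌊ a ≟ᶠ i ⌋) (toList e))

tabulate-𝟙-≟≡unit : ∀ {m} (x : Fin m) → tabulate (λ i → 𝟙 ⌊ x ≟ᶠ i ⌋) ≡ unit x
tabulate-𝟙-≟≡unit {suc m} zero    = cong (1 ∷_) tabulate-0
tabulate-𝟙-≟≡unit {suc m} (suc x) = cong (0 ∷_) (trans (tabulate-cong (λ i → cong 𝟙 (≟-suc i))) (tabulate-𝟙-≟≡unit x))
  where
  ≟-suc : ∀ i → ⌊ suc x ≟ᶠ suc i ⌋ ≡ ⌊ x ≟ᶠ i ⌋
  ≟-suc i with x ≟ᶠ i
  ... | yes _ = refl
  ... | no  _ = refl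

letterCounts-∷ : ∀ {m L} (x : Fin m) (e : Vec (Fin m) L) → letterCounts (x ∷ e) ≡ unit x +ᵥ letterCounts e
letterCounts-∷ x e = trans (tabulate-+ (λ i → 𝟙 ⌊ x ≟ᶠ i ⌋) _) (cong (_+ᵥ letterCounts e) (tabulate-𝟙-≟≡unit x))

words : ∀ m L → List (Vec (Fin m) L)
words m L = allVec L (allFin m)

∑-words : ∀ {m} L (h : Vec ℕ m → ℕ) → ∑[ e ← words m L ] h (letterCounts e) ≡ wordSum L h
∑-words zero    h = trans (+-identityʳ _) (cong h tabulate-0)
∑-words {m} (suc L) h =
  trans (∑-allVec-suc L (allFin m) _)
        (∑-cong (allFin m) (λ x → trans (∑-cong (words m L) (λ e → cong h (letterCounts-∷ x e)))
                                        (∑-words L (λ c → h (unit x +ᵥ c)))))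

coweight : ∀ {n} → Vec Bool n → ℕ
coweight []          = 0
coweight (true  ∷ s) = coweight s
coweight (false ∷ s) = suc (coweight s)

weight+coweight : ∀ {n} (s : Vec Bool n) → weight s + coweight s ≡ n
weight+coweight []          = refl
weight+coweight (true  ∷ s) = cong suc (weight+coweight s)
weight+coweight (false ∷ s) = trans (+-suc (weight s) (coweight s)) (cong suc (weight+coweight s))

module _ {n m Δ : ℕ} (e : Vec (Fin m) Δ) (G : Graph n m Δ) where

  degreeVec-∷ : degreeVec {m = m} (e ∷ G) ≡ letterCounts e +ᵥ degreeVec G
  degreeVec-∷ = tabulate-+ _ _

  Yvec-infected∷ : ∀ s → Yvec ((e ∷ G) , (true ∷ s)) ≡ letterCounts e +ᵥ Yvec (G , s)
  Yvec-infected∷ s = tabulate-+ _ _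

∑-graphs : ∀ {n m Δ} (s : Vec Bool n) (h : Vec ℕ m → Vec ℕ m → ℕ) →
  ∑[ G ← allGraphs n m Δ ] h (Yvec (G , s)) (degreeVec G)
    ≡ wordSum (weight s * Δ) (λ a → wordSum (coweight s * Δ) (λ b → h a (a +ᵥ b)))
∑-graphs []          h = trans (+-identityʳ _) (cong₂ h tabulate-0 (trans tabulate-0 (sym (0ᵥ-+ᵥ 0ᵥ))))
∑-graphs {suc n} {m} {Δ} (true ∷ s) h = begin
  ∑[ G ← allGraphs (suc n) m Δ ] h (Yvec (G , (true ∷ s))) (degreeVec G)
    ≡⟨ ∑-allVec-suc n (words m Δ) _ ⟩
  ∑[ e ← words m Δ ] ∑[ G ← allGraphs n m Δ ] h (Yvec ((e ∷ G) , (true ∷ s))) (degreeVec (e ∷ G))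
    ≡⟨ ∑-cong (words m Δ) (λ e → trans (∑-cong (allGraphs n m Δ) (λ G → cong₂ h (Yvec-infected∷ e G s) (degreeVec-∷ e G)))
                                     (∑-graphs s (λ a d → h (letterCounts e +ᵥ a) (letterCounts e +ᵥ d)))) ⟩
  ∑[ e ← words m Δ ] wordSum Lᵢ (λ a → wordSum Lₕ (λ b → h (letterCounts e +ᵥ a) (letterCounts e +ᵥ (a +ᵥ b))))
    ≡⟨ ∑-words Δ (λ c → wordSum Lᵢ (λ a → wordSum Lₕ (λ b → h (c +ᵥ a) (c +ᵥ (a +ᵥ b))))) ⟩
  wordSum Δ (λ c → wordSum Lᵢ (λ a → wordSum Lₕ (λ b → h (c +ᵥ a) (c +ᵥ (a +ᵥ b)))))
    ≡⟨ wordSum-cong Δ (λ c → wordSum-cong Lᵢ (λ a → wordSum-cong Lₕ (λ b → cong (h (c +ᵥ a)) (+ᵥ-assoc c a b)))) ⟨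
  wordSum Δ (λ c → wordSum Lᵢ (λ a → wordSum Lₕ (λ b → h (c +ᵥ a) (c +ᵥ a +ᵥ b))))
    ≡⟨ wordSum-+ Δ Lᵢ (λ a → wordSum Lₕ (λ b → h a (a +ᵥ b))) ⟩
  wordSum (Δ + Lᵢ) (λ a → wordSum Lₕ (λ b → h a (a +ᵥ b)))                                    ∎
  where
  open ≡-Reasoning
  Lᵢ Lₕ : ℕ
  Lᵢ = weight s * Δ
  Lₕ = coweight s * Δ
∑-graphs {suc n} {m} {Δ} (false ∷ s) h = begin
  ∑[ G ← allGraphs (suc n) m Δ ] h (Yvec (G , (false ∷ s))) (degreeVec G)
    ≡⟨ ∑-allVec-suc n (words m Δ) _ ⟩
  ∑[ e ← words m Δ ] ∑[ G ← allGraphs n m Δ ] h (Yvec (G , s)) (degreeVec (e ∷ G))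
    ≡⟨ ∑-cong (words m Δ) (λ e → trans (∑-cong (allGraphs n m Δ) (λ G → cong (h (Yvec (G , s))) (degreeVec-∷ e G)))
                                     (∑-graphs s (λ a d → h a (letterCounts e +ᵥ d)))) ⟩
  ∑[ e ← words m Δ ] wordSum Lᵢ (λ a → wordSum Lₕ (λ b → h a (letterCounts e +ᵥ (a +ᵥ b))))
    ≡⟨ ∑-words Δ (λ c → wordSum Lᵢ (λ a → wordSum Lₕ (λ b → h a (c +ᵥ (a +ᵥ b))))) ⟩
  wordSum Δ (λ c → wordSum Lᵢ (λ a → wordSum Lₕ (λ b → h a (c +ᵥ (a +ᵥ b)))))
    ≡⟨ wordSum-comm Δ Lᵢ (λ c a → wordSum Lₕ (λ b → h a (c +ᵥ (a +ᵥ b)))) ⟩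
  wordSum Lᵢ (λ a → wordSum Δ (λ c → wordSum Lₕ (λ b → h a (c +ᵥ (a +ᵥ b)))))
    ≡⟨ wordSum-cong Lᵢ (λ a → trans (wordSum-cong Δ (λ c → wordSum-cong Lₕ (λ b → cong (h a) (+ᵥ-left-comm c a b))))
                                    (wordSum-+ Δ Lₕ (λ d → h a (a +ᵥ d)))) ⟩
  wordSum Lᵢ (λ a → wordSum (Δ + Lₕ) (λ b → h a (a +ᵥ b)))                                    ∎
  where
  open ≡-Reasoning
  Lᵢ Lₕ : ℕ
  Lᵢ = weight s * Δ
  Lₕ = coweight s * Δ
  +ᵥ-left-comm : ∀ c a b → c +ᵥ (a +ᵥ b) ≡ a +ᵥ (c +ᵥ b)
  +ᵥ-left-comm c a b = trans (sym (+ᵥ-assoc c a b)) (trans (cong (_+ᵥ b) (+ᵥ-comm c a)) (+ᵥ-assoc a c b))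

count-Yvec-degreeVec : ∀ n m Δ k (h : Vec ℕ m → Vec ℕ m → Bool) →
  count (λ ω → h (Yvec ω) (degreeVec (Sample.graph ω))) (allSamples n m Δ k)
    ≡ length (allSigmas n k) * wordSum (k * Δ) (λ a → wordSum ((n ∸ k) * Δ) (λ b → 𝟙 (h a (a +ᵥ b))))
count-Yvec-degreeVec n m Δ k h = begin
  count P (allSamples n m Δ k)                                  ≡⟨ count≡∑𝟙 P (allSamples n m Δ k) ⟩
  ∑[ ω ← allSamples n m Δ k ] 𝟙 (P ω)                           ≡⟨ ∑-concatMap (λ G → map (G ,_) (allSigmas n k)) (allGraphs n m Δ) _ ⟩
  ∑[ G ← allGraphs n m Δ ] ∑ (map (G ,_) (allSigmas n k)) 𝟙∘P   ≡⟨ ∑-cong (allGraphs n m Δ) (λ G → ∑-map (G ,_) (allSigmas n k) _) ⟩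
  ∑[ G ← allGraphs n m Δ ] ∑[ σ ← allSigmas n k ] 𝟙 (P (G , σ)) ≡⟨ ∑-comm (allGraphs n m Δ) (allSigmas n k) _ ⟩
  ∑[ σ ← allSigmas n k ] ∑[ G ← allGraphs n m Δ ] 𝟙 (P (G , σ)) ≡⟨ ∑-cong-All (allSigmas n k) (all-filter (λ σ → weight σ ≟ k) (allVec n (true ∷ false ∷ []))) per-σ ⟩
  ∑[ σ ← allSigmas n k ] N                                      ≡⟨ ∑-const (allSigmas n k) N ⟩
  length (allSigmas n k) * N                                    ∎
  where
  open ≡-Reasoning
  P : Sample n m Δ → Bool
  P ω = h (Yvec ω) (degreeVec (Sample.graph ω))
  𝟙∘P : Sample n m Δ → ℕ
  𝟙∘P ω = 𝟙 (P ω)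
  N : ℕ
  N = wordSum (k * Δ) (λ a → wordSum ((n ∸ k) * Δ) (λ b → 𝟙 (h a (a +ᵥ b))))
  per-σ : ∀ σ → weight σ ≡ k → ∑[ G ← allGraphs n m Δ ] 𝟙 (P (G , σ)) ≡ N
  per-σ σ refl = trans (∑-graphs σ (λ a d → 𝟙 (h a d)))
    (cong (λ c → wordSum (weight σ * Δ) (λ a → wordSum (c * Δ) (λ b → 𝟙 (h a (a +ᵥ b)))))
          (sym (trans (cong (_∸ weight σ) (sym (weight+coweight σ))) (m+n∸m≡n (weight σ) (coweight σ)))))

-- Pairs of words with prescribed letter counts

∑-upTo-𝟙-≡ᵇ : ∀ g y → ∑[ i ← upTo g ] 𝟙 (i ≡ᵇ y) ≡ 𝟙 (y ≤ᵇ g)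
∑-upTo-𝟙-≡ᵇ g y = trans (cong (𝟙 (0 ≡ᵇ y) +_) (trans (cong (λ is → ∑ is (λ i → 𝟙 (i ≡ᵇ y))) (sym (map-upTo suc g)))
                                                        (∑-map suc (List.upTo g) _)))
                          (shifted g y)
  where
  ≤ᵇ-suc : ∀ a b → (suc a ≤ᵇ suc b) ≡ (a ≤ᵇ b)
  ≤ᵇ-suc zero    b = refl
  ≤ᵇ-suc (suc a) b = refl
  shifted : ∀ g y → 𝟙 (0 ≡ᵇ y) + ∑[ i ← List.upTo g ] 𝟙 (suc i ≡ᵇ y) ≡ 𝟙 (y ≤ᵇ g)
  shifted g       zero    = cong suc (∑-zero (List.upTo g))
  shifted zero    (suc y) = refl
  shifted (suc g) (suc y) = trans (∑-upTo-𝟙-≡ᵇ g y) (cong 𝟙 (sym (≤ᵇ-suc y g)))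

∑-box-𝟙-≡ᵇᵛ : ∀ {m} (g y : Vec ℕ m) → ∑[ x ← box g ] 𝟙 (x ≡ᵇᵛ y) ≡ 𝟙 (y ≤ᵇᵛ g)
∑-box-𝟙-≡ᵇᵛ []      []      = refl
∑-box-𝟙-≡ᵇᵛ (a ∷ g) (b ∷ y) = begin
  ∑[ x ← box (a ∷ g) ] 𝟙 (x ≡ᵇᵛ b ∷ y)                           ≡⟨ ∑-concatMap (λ i → map (i ∷_) (box g)) (upTo a) _ ⟩
  ∑[ i ← upTo a ] ∑ (map (i ∷_) (box g)) (λ x → 𝟙 (x ≡ᵇᵛ b ∷ y)) ≡⟨ ∑-cong (upTo a) row ⟩
  ∑[ i ← upTo a ] (𝟙 (i ≡ᵇ b) * 𝟙 (y ≤ᵇᵛ g))                     ≡⟨ *-distribʳ-∑ (upTo a) (𝟙 (y ≤ᵇᵛ g)) (λ i → 𝟙 (i ≡ᵇ b)) ⟩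
  ∑[ i ← upTo a ] 𝟙 (i ≡ᵇ b) * 𝟙 (y ≤ᵇᵛ g)                       ≡⟨ cong (_* 𝟙 (y ≤ᵇᵛ g)) (∑-upTo-𝟙-≡ᵇ a b) ⟩
  𝟙 (b ≤ᵇ a) * 𝟙 (y ≤ᵇᵛ g)                                       ≡⟨ 𝟙-∧ (b ≤ᵇ a) _ ⟨
  𝟙 ((b ≤ᵇ a) ∧ (y ≤ᵇᵛ g))                                       ∎
  where
  open ≡-Reasoning
  row : ∀ i → ∑ (map (i ∷_) (box g)) (λ x → 𝟙 (x ≡ᵇᵛ b ∷ y)) ≡ 𝟙 (i ≡ᵇ b) * 𝟙 (y ≤ᵇᵛ g)
  row i = begin
    ∑ (map (i ∷_) (box g)) (λ x → 𝟙 (x ≡ᵇᵛ b ∷ y)) ≡⟨ ∑-map (i ∷_) (box g) _ ⟩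
    ∑[ x ← box g ] 𝟙 ((i ≡ᵇ b) ∧ (x ≡ᵇᵛ y))        ≡⟨ ∑-cong (box g) (λ x → 𝟙-∧ (i ≡ᵇ b) (x ≡ᵇᵛ y)) ⟩
    ∑[ x ← box g ] (𝟙 (i ≡ᵇ b) * 𝟙 (x ≡ᵇᵛ y))      ≡⟨ *-distribˡ-∑ (box g) (𝟙 (i ≡ᵇ b)) _ ⟩
    𝟙 (i ≡ᵇ b) * ∑[ x ← box g ] 𝟙 (x ≡ᵇᵛ y)        ≡⟨ cong (𝟙 (i ≡ᵇ b) *_) (∑-box-𝟙-≡ᵇᵛ g y) ⟩
    𝟙 (i ≡ᵇ b) * 𝟙 (y ≤ᵇᵛ g)                       ∎

box-≤ : ∀ {m} (g : Vec ℕ m) → All (λ x → (x ≤ᵇᵛ g) ≡ true) (box g)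
box-≤ []      = refl ∷ []
box-≤ (a ∷ g) = concat⁺ (map⁺ (applyUpTo⁺₁ (λ i → i) (suc a) row))
  where
  row : ∀ {i} → i < suc a → All (λ x → (x ≤ᵇᵛ a ∷ g) ≡ true) (map (i ∷_) (box g))
  row (s≤s i≤a) = map⁺ (All.map (λ x≤g → cong₂ _∧_ (≤⇒≤ᵇ≡true i≤a) x≤g) (box-≤ g))

multinomial≢0⇒vsum≡ : ∀ {m} L (y : Vec ℕ m) → multinomial L y ≢ 0 → vsum y ≡ L
multinomial≢0⇒vsum≡ L y M≢0 with vsum y ≡ᵇ L in e
... | true  = ≡ᵇ-true⇒≡ (vsum y) L e
... | false = ⊥-elim (M≢0 (*-cancelʳ-≡ (multinomial L y) 0 (∏! y) {{∏!-nonZero y}}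
                                        (trans (multinomial-*-∏! L y) (cong (λ b → 𝟙 b * L !) e))))

-- proportional to P(X = y ∧ Σ X = s | Γ = g) for y ≤ g
binomialWeight : ∀ {m} → ℕ → Vec ℕ m → Vec ℕ m → ℕ
binomialWeight s g y = 𝟙 (vsum y ≡ᵇ s) * ∏C g y

module _ {m : ℕ} (s t : ℕ) (g : Vec ℕ m) where

  -- the number of pairs of words of lengths s and t whose letter counts are y and g ∸ᵥ y
  jointCount : Vec ℕ m → ℕ
  jointCount y = multinomial s y * (𝟙 (y ≤ᵇᵛ g) * multinomial t (g ∸ᵥ y))

  private
    completions : Vec ℕ m → ℕ
    completions a = wordSum t (λ b → 𝟙 (a +ᵥ b ≡ᵇᵛ g))

    completions≡ : ∀ a → completions a ≡ 𝟙 (a ≤ᵇᵛ g) * multinomial t (g ∸ᵥ a)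
    completions≡ a = trans (wordSum-cong t (λ b → 𝟙-+ᵥ≡ᵇᵛ a b g)) (*-distribˡ-wordSum t (𝟙 (a ≤ᵇᵛ g)) _)

    jointCount≡wordSum : ∀ y → wordSum s (λ a → 𝟙 (a ≡ᵇᵛ y) * completions a) ≡ jointCount y
    jointCount≡wordSum y = trans (wordSum-𝟙-≡ᵇᵛ s y completions) (cong (multinomial s y *_) (completions≡ y))

  wordPairs-Γ≡g : wordSum s (λ a → wordSum t (λ b → 𝟙 ((a +ᵥ b) ≟ᵛ g))) ≡ multinomial (s + t) g
  wordPairs-Γ≡g = trans (wordSum-cong s (λ a → wordSum-cong t (λ b → cong 𝟙 (≟ᵛ≡≡ᵇᵛ (a +ᵥ b) g))))
                        (wordSum-+ s t (λ d → 𝟙 (d ≡ᵇᵛ g)))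

  wordPairs-Γ≡g∧Y≡y : ∀ y → wordSum s (λ a → wordSum t (λ b → 𝟙 (((a +ᵥ b) ≟ᵛ g) ∧ (a ≟ᵛ y)))) ≡ jointCount y
  wordPairs-Γ≡g∧Y≡y y = trans (wordSum-cong s inner) (jointCount≡wordSum y)
    where
    inner : ∀ a → wordSum t (λ b → 𝟙 (((a +ᵥ b) ≟ᵛ g) ∧ (a ≟ᵛ y))) ≡ 𝟙 (a ≡ᵇᵛ y) * completions a
    inner a = trans (wordSum-cong t (λ b → begin
        𝟙 (((a +ᵥ b) ≟ᵛ g) ∧ (a ≟ᵛ y)) ≡⟨ cong₂ (λ u v → 𝟙 (u ∧ v)) (≟ᵛ≡≡ᵇᵛ (a +ᵥ b) g) (≟ᵛ≡≡ᵇᵛ a y) ⟩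
        𝟙 ((a +ᵥ b ≡ᵇᵛ g) ∧ (a ≡ᵇᵛ y)) ≡⟨ cong 𝟙 (∧-comm (a +ᵥ b ≡ᵇᵛ g) _) ⟩
        𝟙 ((a ≡ᵇᵛ y) ∧ (a +ᵥ b ≡ᵇᵛ g)) ≡⟨ 𝟙-∧ (a ≡ᵇᵛ y) _ ⟩
        𝟙 (a ≡ᵇᵛ y) * 𝟙 (a +ᵥ b ≡ᵇᵛ g) ∎))
      (*-distribˡ-wordSum t (𝟙 (a ≡ᵇᵛ y)) _)
      where open ≡-Reasoning

  ∑-box-jointCount : ∑[ y ← box g ] jointCount y ≡ multinomial (s + t) g
  ∑-box-jointCount = begin
    ∑[ y ← box g ] jointCount y                                    ≡⟨ ∑-cong (box g) jointCount≡wordSum ⟨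
    ∑[ y ← box g ] wordSum s (λ a → 𝟙 (a ≡ᵇᵛ y) * completions a)   ≡⟨ wordSum-∑ s (box g) _ ⟨
    wordSum s (λ a → ∑[ y ← box g ] (𝟙 (a ≡ᵇᵛ y) * completions a)) ≡⟨ wordSum-cong s marginal ⟩
    wordSum s completions                                          ≡⟨ wordSum-+ s t (λ d → 𝟙 (d ≡ᵇᵛ g)) ⟩
    multinomial (s + t) g                                          ∎
    where
    open ≡-Reasoning
    -- completions a vanishes unless a ≤ g, i.e. unless a lies in the box
    marginal : ∀ a → ∑[ y ← box g ] (𝟙 (a ≡ᵇᵛ y) * completions a) ≡ completions a
    marginal a with a ≤ᵇᵛ g in e
    ... | true = begin
      ∑[ y ← box g ] (𝟙 (a ≡ᵇᵛ y) * completions a) ≡⟨ *-distribʳ-∑ (box g) (completions a) _ ⟩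
      ∑[ y ← box g ] 𝟙 (a ≡ᵇᵛ y) * completions a   ≡⟨ cong (_* completions a) (∑-cong (box g) (λ y → cong 𝟙 (≡ᵇᵛ-comm a y))) ⟩
      ∑[ y ← box g ] 𝟙 (y ≡ᵇᵛ a) * completions a   ≡⟨ cong (_* completions a) (trans (∑-box-𝟙-≡ᵇᵛ g a) (cong 𝟙 e)) ⟩
      1 * completions a                            ≡⟨ *-identityˡ (completions a) ⟩
      completions a                                ∎
    ... | false = trans (∑-cong (box g) (λ y → cong (𝟙 (a ≡ᵇᵛ y) *_) zero-fibre))
                        (trans (∑-cong (box g) (λ y → *-zeroʳ (𝟙 (a ≡ᵇᵛ y)))) (trans (∑-zero (box g)) (sym zero-fibre)))
      where
      zero-fibre : completions a ≡ 0
      zero-fibre = trans (completions≡ a) (cong (λ b → 𝟙 b * multinomial t (g ∸ᵥ a)) e)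

  ∑-box-X≡y∧E : ∀ y → ∑[ x ← box g ] (𝟙 ((x ≟ᵛ y) ∧ (vsum x ≡ᵇ s)) * ∏C g x) ≡ 𝟙 (y ≤ᵇᵛ g) * binomialWeight s g y
  ∑-box-X≡y∧E y = begin
    ∑[ x ← box g ] (𝟙 ((x ≟ᵛ y) ∧ (vsum x ≡ᵇ s)) * ∏C g x) ≡⟨ ∑-cong (box g) split ⟩
    ∑[ x ← box g ] (𝟙 (x ≡ᵇᵛ y) * binomialWeight s g x)    ≡⟨ ∑-cong (box g) (𝟙-≡ᵇᵛ-subst y (binomialWeight s g)) ⟩
    ∑[ x ← box g ] (𝟙 (x ≡ᵇᵛ y) * binomialWeight s g y)    ≡⟨ *-distribʳ-∑ (box g) (binomialWeight s g y) _ ⟩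
    ∑[ x ← box g ] 𝟙 (x ≡ᵇᵛ y) * binomialWeight s g y      ≡⟨ cong (_* binomialWeight s g y) (∑-box-𝟙-≡ᵇᵛ g y) ⟩
    𝟙 (y ≤ᵇᵛ g) * binomialWeight s g y                     ∎
    where
    open ≡-Reasoning
    split : ∀ x → 𝟙 ((x ≟ᵛ y) ∧ (vsum x ≡ᵇ s)) * ∏C g x ≡ 𝟙 (x ≡ᵇᵛ y) * binomialWeight s g x
    split x = trans (cong (λ b → 𝟙 (b ∧ (vsum x ≡ᵇ s)) * ∏C g x) (≟ᵛ≡≡ᵇᵛ x y))
                    (trans (cong (_* ∏C g x) (𝟙-∧ (x ≡ᵇᵛ y) _)) (*-assoc (𝟙 (x ≡ᵇᵛ y)) _ _))

  module _ (vsum-g : vsum g ≡ s + t) where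

    jointCount-*-∏! : ∀ y → (y ≤ᵇᵛ g) ≡ true → jointCount y * ∏! g ≡ binomialWeight s g y * (s ! * t !)
    jointCount-*-∏! y y≤g = begin
      multinomial s y * (𝟙 (y ≤ᵇᵛ g) * multinomial t r) * ∏! g
        ≡⟨ cong₂ (λ b c → multinomial s y * (𝟙 b * multinomial t r) * c) y≤g (∏!-split g y y≤g) ⟩
      multinomial s y * (1 * multinomial t r) * (∏C g y * (∏! y * ∏! r))
        ≡⟨ regroup (multinomial s y) (multinomial t r) (∏C g y) (∏! y) (∏! r) ⟩
      (multinomial s y * ∏! y) * (multinomial t r * ∏! r) * ∏C g y
        ≡⟨ cong₂ (λ a b → a * b * ∏C g y) (multinomial-*-∏! s y) (multinomial-*-∏! t r) ⟩
      (𝟙 (vsum y ≡ᵇ s) * s !) * (𝟙 (vsum r ≡ᵇ t) * t !) * ∏C g y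
        ≡⟨ regroup′ (𝟙 (vsum y ≡ᵇ s)) (s !) (𝟙 (vsum r ≡ᵇ t)) (t !) (∏C g y) ⟩
      𝟙 (vsum y ≡ᵇ s) * 𝟙 (vsum r ≡ᵇ t) * ∏C g y * (s ! * t !)
        ≡⟨ cong (λ z → z * ∏C g y * (s ! * t !)) complement ⟩
      𝟙 (vsum y ≡ᵇ s) * ∏C g y * (s ! * t !)                          ∎
      where
      open ≡-Reasoning
      r : Vec ℕ m
      r = g ∸ᵥ y
      regroup : ∀ a b c d e → a * (1 * b) * (c * (d * e)) ≡ a * d * (b * e) * c
      regroup = solve-∀
      regroup′ : ∀ a b c d e → a * b * (c * d) * e ≡ a * c * e * (b * d)
      regroup′ = solve-∀
      -- if y has s letters then its complement in g has the remaining t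
      complement : 𝟙 (vsum y ≡ᵇ s) * 𝟙 (vsum r ≡ᵇ t) ≡ 𝟙 (vsum y ≡ᵇ s)
      complement with vsum y ≡ᵇ s in e
      ... | false = refl
      ... | true  = trans (*-identityˡ _) (cong 𝟙 (trans (cong (_≡ᵇ t) vsum-r) (≡ᵇ-refl t)))
        where
        vsum-r : vsum r ≡ t
        vsum-r = +-cancelʳ-≡ (vsum y) (vsum r) t
          (trans (vsum-∸ᵥ g y y≤g) (trans vsum-g (trans (+-comm s t) (cong (t +_) (sym (≡ᵇ-true⇒≡ (vsum y) s e))))))

    ∑-box-binomialWeight : (∑[ x ← box g ] binomialWeight s g x) * (s ! * t !) ≡ multinomial (s + t) g * ∏! g
    ∑-box-binomialWeight = begin
      (∑[ x ← box g ] binomialWeight s g x) * (s ! * t !) ≡⟨ *-distribʳ-∑ (box g) (s ! * t !) (binomialWeight s g) ⟨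
      ∑[ x ← box g ] (binomialWeight s g x * (s ! * t !)) ≡⟨ ∑-cong-All (box g) (box-≤ g) (λ x x≤g → sym (jointCount-*-∏! x x≤g)) ⟩
      ∑[ x ← box g ] (jointCount x * ∏! g)                ≡⟨ *-distribʳ-∑ (box g) (∏! g) jointCount ⟩
      (∑[ x ← box g ] jointCount x) * ∏! g                ≡⟨ cong (_* ∏! g) ∑-box-jointCount ⟩
      multinomial (s + t) g * ∏! g                        ∎
      where open ≡-Reasoning

    ∑-box-binomialWeight-nonZero : multinomial (s + t) g ≢ 0 → NonZero (∑[ x ← box g ] binomialWeight s g x)
    ∑-box-binomialWeight-nonZero M≢0 = m*n≢0⇒m≢0 _ {{subst NonZero (sym ∑-box-binomialWeight)
                                                             (m*n≢0 _ (∏! g) {{≢-nonZero M≢0}} {{∏!-nonZero g}})}}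

    jointCount-*-∑-box : ∀ y → jointCount y * (∑[ x ← box g ] binomialWeight s g x)
                               ≡ 𝟙 (y ≤ᵇᵛ g) * binomialWeight s g y * multinomial (s + t) g
    jointCount-*-∑-box y = by-cases (y ≤ᵇᵛ g) refl
      where
      S K M : ℕ
      S = ∑[ x ← box g ] binomialWeight s g x
      K = s ! * t !
      M = multinomial (s + t) g
      regroup : ∀ a b c d → a * b * (c * d) ≡ a * c * (d * b)
      regroup = solve-∀
      in-box : (y ≤ᵇᵛ g) ≡ true → jointCount y * S ≡ binomialWeight s g y * M
      in-box y≤g = *-cancelʳ-≡ _ _ (∏! g * K) {{m*n≢0 _ _ {{∏!-nonZero g}} {{m*n≢0 (s !) (t !) {{s !≢0}} {{t !≢0}}}}}} (begin
        jointCount y * S * (∏! g * K)         ≡⟨ *-interchange (jointCount y) S (∏! g) K ⟩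
        (jointCount y * ∏! g) * (S * K)       ≡⟨ cong₂ _*_ (jointCount-*-∏! y y≤g) ∑-box-binomialWeight ⟩
        binomialWeight s g y * K * (M * ∏! g) ≡⟨ regroup (binomialWeight s g y) K M (∏! g) ⟩
        binomialWeight s g y * M * (∏! g * K) ∎)
        where open ≡-Reasoning
      by-cases : ∀ b → (y ≤ᵇᵛ g) ≡ b → jointCount y * S ≡ 𝟙 (y ≤ᵇᵛ g) * binomialWeight s g y * M
      by-cases true  e = trans (in-box e)
                               (sym (trans (cong (λ b → 𝟙 b * binomialWeight s g y * M) e) (cong (_* M) (*-identityˡ (binomialWeight s g y)))))
      by-cases false e = trans (cong (λ b → multinomial s y * (𝟙 b * multinomial t (g ∸ᵥ y)) * S) e)
                               (trans (cong (_* S) (*-zeroʳ (multinomial s y))) (cong (λ b → 𝟙 b * binomialWeight s g y * M) (sym e)))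

-- Rational arithmetic and the binomial model

frac-* : ∀ a d b e → frac a (suc d) *ℚ frac b (suc e) ≡ frac (a * b) (suc d * suc e)
frac-* a d b e = ℚ.toℚᵘ-injective (begin
  toℚᵘ (frac a (suc d) *ℚ frac b (suc e))          ≈⟨ ℚ.toℚᵘ-homo-* (frac a (suc d)) (frac b (suc e)) ⟩
  toℚᵘ (frac a (suc d)) ℚᵘ.* toℚᵘ (frac b (suc e)) ≈⟨ ℚᵘ.*-cong (ℚ.toℚᵘ-fromℚᵘ (mkℚᵘ (ℤ.+ a) d)) (ℚ.toℚᵘ-fromℚᵘ (mkℚᵘ (ℤ.+ b) e)) ⟩
  mkℚᵘ (ℤ.+ a) d ℚᵘ.* mkℚᵘ (ℤ.+ b) e               ≈⟨ *≡* (cong (ℤ._* (ℤ.+ (suc d * suc e))) (sym (ℤ.pos-* a b))) ⟩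
  mkℚᵘ (ℤ.+ (a * b)) (pred (suc d * suc e))        ≈⟨ ℚ.toℚᵘ-fromℚᵘ (mkℚᵘ (ℤ.+ (a * b)) _) ⟨
  toℚᵘ (frac (a * b) (suc d * suc e))              ∎)
  where open ℚᵘ.≃-Reasoning

frac-zero : ∀ d → frac 0 d ≡ 0ℚ
frac-zero zero    = refl
frac-zero (suc d) = ℚ.0/n≡0 (suc d)

frac-+ : ∀ a b → frac a 1 +ℚ frac b 1 ≡ frac (a + b) 1
frac-+ a b = ℚ.toℚᵘ-injective (begin
  toℚᵘ (frac a 1 +ℚ frac b 1)              ≈⟨ ℚ.toℚᵘ-homo-+ (frac a 1) (frac b 1) ⟩
  toℚᵘ (frac a 1) ℚᵘ.+ toℚᵘ (frac b 1)   ≈⟨ ℚᵘ.+-cong (ℚ.toℚᵘ-fromℚᵘ (mkℚᵘ (ℤ.+ a) 0)) (ℚ.toℚᵘ-fromℚᵘ (mkℚᵘ (ℤ.+ b) 0)) ⟩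
  mkℚᵘ (ℤ.+ a) 0 ℚᵘ.+ mkℚᵘ (ℤ.+ b) 0         ≈⟨ *≡* (cong (ℤ._* ℤ.+ 1) (trans (cong₂ ℤ._+_ (ℤ.*-identityʳ (ℤ.+ a)) (ℤ.*-identityʳ (ℤ.+ b)))
                                                                          (sym (ℤ.pos-+ a b)))) ⟩
  mkℚᵘ (ℤ.+ (a + b)) 0  ≈⟨ ℚ.toℚᵘ-fromℚᵘ (mkℚᵘ (ℤ.+ (a + b)) 0) ⟨
  toℚᵘ (frac (a + b) 1) ∎)
  where open ℚᵘ.≃-Reasoning

1-frac : ∀ k d → k ≤ suc d → 1ℚ - frac k (suc d) ≡ frac (suc d ∸ k) (suc d)
1-frac k d k≤1+d = ℚ.toℚᵘ-injective (begin
  toℚᵘ (1ℚ - frac k (suc d))                 ≈⟨ ℚ.toℚᵘ-homo-+ 1ℚ (ℚ.- frac k (suc d)) ⟩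
  ℚᵘ.1ℚᵘ ℚᵘ.+ toℚᵘ (ℚ.- frac k (suc d))
    ≈⟨ ℚᵘ.+-congʳ ℚᵘ.1ℚᵘ (ℚᵘ.≃-trans (ℚ.toℚᵘ-homo‿- (frac k (suc d))) (ℚᵘ.-‿cong (ℚ.toℚᵘ-fromℚᵘ (mkℚᵘ (ℤ.+ k) d)))) ⟩
  ℚᵘ.1ℚᵘ ℚᵘ.- mkℚᵘ (ℤ.+ k) d      ≈⟨ *≡* cross ⟩
  mkℚᵘ (ℤ.+ (suc d ∸ k)) d        ≈⟨ ℚ.toℚᵘ-fromℚᵘ (mkℚᵘ (ℤ.+ (suc d ∸ k)) d) ⟨
  toℚᵘ (frac (suc d ∸ k) (suc d)) ∎)
  where
  open ℚᵘ.≃-Reasoning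
  cross : (ℤ.+ 1 ℤ.* ℤ.+ suc d ℤ.+ ℤ.- ℤ.+ k ℤ.* ℤ.+ 1) ℤ.* ℤ.+ suc d ≡ ℤ.+ (suc d ∸ k) ℤ.* (ℤ.+ 1 ℤ.* ℤ.+ suc d)
  cross = trans (cong (ℤ._* ℤ.+ suc d) (cong₂ ℤ._+_ (ℤ.*-identityˡ (ℤ.+ suc d)) (ℤ.*-identityʳ (ℤ.- ℤ.+ k))))
                (cong₂ ℤ._*_ (trans (ℤ.[+m]-[+n]≡m⊖n (suc d) k) (ℤ.⊖-≥ k≤1+d)) (sym (ℤ.*-identityˡ (ℤ.+ suc d))))

frac-pos : ∀ a d → NonZero a → Positive (frac a (suc d))
frac-pos (suc a) d _ = ℚ.normalize-pos (suc a) (suc d)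

^ℚ-pos : ∀ x e → (NonZero e → Positive x) → Positive (x ^ℚ e)
^ℚ-pos x zero    _     = _
^ℚ-pos x (suc e) x>0 = ℚ.pos*pos⇒pos x {{x>0 _}} (x ^ℚ e) {{^ℚ-pos x e (λ _ → x>0 _)}}

^ℚ-+ : ∀ x a b → x ^ℚ (a + b) ≡ x ^ℚ a *ℚ x ^ℚ b
^ℚ-+ x zero    b = sym (ℚ.*-identityˡ (x ^ℚ b))
^ℚ-+ x (suc a) b = trans (cong (x *ℚ_) (^ℚ-+ x a b)) (sym (ℚ.*-assoc x (x ^ℚ a) (x ^ℚ b)))

frac-k/n-pos : ∀ k n → k ≤ n → NonZero k → Positive (frac k n)
frac-k/n-pos (suc k) (suc n) _ k≢0 = frac-pos (suc k) n k≢0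

1-frac-k/n-pos : ∀ k n → NonZero (n ∸ k) → Positive (1ℚ - frac k n)
1-frac-k/n-pos k zero    0∸k≢0 = ⊥-elim (≢-nonZero⁻¹ (0 ∸ k) {{0∸k≢0}} (0∸n≡0 k))
1-frac-k/n-pos k (suc n) n∸k≢0 = subst Positive (sym (1-frac k n k≤1+n)) (frac-pos (suc n ∸ k) n n∸k≢0)
  where
  k≤1+n : k ≤ suc n
  k≤1+n = <⇒≤ (m∸n≢0⇒n<m (≢-nonZero⁻¹ (suc n ∸ k) {{n∸k≢0}}))

prodPmf≡ : ∀ {m} (g x : Vec ℕ m) p →
           prodPmf g p x ≡ frac (∏C g x) 1 *ℚ (p ^ℚ vsum x *ℚ (1ℚ - p) ^ℚ vsum (g ∸ᵥ x))
prodPmf≡ []      []      p = refl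
prodPmf≡ (a ∷ g) (b ∷ x) p = begin
  binPmf a p b *ℚ prodPmf g p x
    ≡⟨ cong (binPmf a p b *ℚ_) (prodPmf≡ g x p) ⟩
  frac (a C b) 1 *ℚ (p ^ℚ b *ℚ q ^ℚ (a ∸ b)) *ℚ (frac (∏C g x) 1 *ℚ (p ^ℚ vsum x *ℚ q ^ℚ vsum (g ∸ᵥ x)))
    ≡⟨ interchange (frac (a C b) 1) (p ^ℚ b) (q ^ℚ (a ∸ b)) (frac (∏C g x) 1) (p ^ℚ vsum x) (q ^ℚ vsum (g ∸ᵥ x)) ⟩
  frac (a C b) 1 *ℚ frac (∏C g x) 1 *ℚ (p ^ℚ b *ℚ p ^ℚ vsum x *ℚ (q ^ℚ (a ∸ b) *ℚ q ^ℚ vsum (g ∸ᵥ x)))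
    ≡⟨ cong₂ _*ℚ_ (frac-* (a C b) 0 (∏C g x) 0) (cong₂ _*ℚ_ (sym (^ℚ-+ p b (vsum x))) (sym (^ℚ-+ q (a ∸ b) (vsum (g ∸ᵥ x))))) ⟩
  frac ((a C b) * ∏C g x) 1 *ℚ (p ^ℚ (b + vsum x) *ℚ q ^ℚ (a ∸ b + vsum (g ∸ᵥ x)))  ∎
  where
  open ≡-Reasoning
  open +-*-Solver
  q : ℚ
  q = 1ℚ - p
  interchange : ∀ u v w x y z → u *ℚ (v *ℚ w) *ℚ (x *ℚ (y *ℚ z)) ≡ u *ℚ x *ℚ (v *ℚ y *ℚ (w *ℚ z))
  interchange = solve 6 (λ u v w x y z → u :* (v :* w) :* (x :* (y :* z)) := u :* x :* (v :* y :* (w :* z))) refl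

sumℚ-map≡frac : ∀ {A : Set} (xs : List A) (f : A → ℚ) (h : A → ℕ) r →
                All (λ x → f x ≡ frac (h x) 1 *ℚ r) xs → sumℚ (map f xs) ≡ frac (∑ xs h) 1 *ℚ r
sumℚ-map≡frac []       f h r []       = sym (ℚ.*-zeroˡ r)
sumℚ-map≡frac (x ∷ xs) f h r (e ∷ es) =
  trans (cong₂ _+ℚ_ e (sumℚ-map≡frac xs f h r es))
        (trans (sym (ℚ.*-distribʳ-+ r (frac (h x) 1) (frac (∑ xs h) 1))) (cong (_*ℚ r) (frac-+ (h x) (∑ xs h))))

probX≡ : ∀ {m} (g : Vec ℕ m) p s t (Q : Vec ℕ m → Bool) → vsum g ≡ s + t → (∀ x → Q x ≡ true → vsum x ≡ s) →
         probX g p Q ≡ frac (∑[ x ← box g ] (𝟙 (Q x) * ∏C g x)) 1 *ℚ (p ^ℚ s *ℚ (1ℚ - p) ^ℚ t)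
probX≡ g p s t Q vsum-g Q⇒s =
  trans (sumℚ-map≡frac _ (prodPmf g p) (∏C g) _ (All.map pmf (All.zip (filter⁺ Q? (box-≤ g) , all-filter Q? (box g)))))
        (cong (λ z → frac z 1 *ℚ (p ^ℚ s *ℚ (1ℚ - p) ^ℚ t)) (∑-filter Q (box g) (∏C g)))
  where
  Q? : ∀ x → Dec (Q x ≡ true)
  Q? x = Q x Bool.≟ true
  pmf : ∀ {x} → (x ≤ᵇᵛ g) ≡ true Data.Product.× Q x ≡ true → prodPmf g p x ≡ frac (∏C g x) 1 *ℚ (p ^ℚ s *ℚ (1ℚ - p) ^ℚ t)
  pmf {x} (x≤g , Qx) = trans (prodPmf≡ g x p) (cong₂ (λ a b → frac (∏C g x) 1 *ℚ (p ^ℚ a *ℚ (1ℚ - p) ^ℚ b)) (Q⇒s x Qx) vsum-rest)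
    where
    vsum-rest : vsum (g ∸ᵥ x) ≡ t
    vsum-rest = +-cancelʳ-≡ (vsum x) (vsum (g ∸ᵥ x)) t
      (trans (vsum-∸ᵥ g x x≤g) (trans vsum-g (trans (+-comm s t) (cong (t +_) (sym (Q⇒s x Qx))))))

pos⇒≢0 : ∀ p → Positive p → p ≢ 0ℚ
pos⇒≢0 (mkℚ +[1+ _ ] _ _) _ ()

condℚ≡÷ : ∀ a b (b≢0 : b ≢ 0ℚ) → condℚ a b ≡ (a ÷ b) {{ℚ.≢-nonZero b≢0}}
condℚ≡÷ a b@(mkℚ (ℤ.+ 0)      _ _) b≢0 = ⊥-elim (b≢0 (ℚ.↥p≡0⇒p≡0 b refl))
condℚ≡÷ a   (mkℚ +[1+ _ ] _ _) _   = refl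
condℚ≡÷ a   (mkℚ -[1+ _ ] _ _) _   = refl

÷-cross : ∀ a b c d .{{_ : ℚ.NonZero b}} .{{_ : ℚ.NonZero d}} → a *ℚ d ≡ c *ℚ b → a ÷ b ≡ c ÷ d
÷-cross a b c d ad≡cb = begin
  a *ℚ 1/ b                ≡⟨ ℚ.*-identityʳ (a *ℚ 1/ b) ⟨
  a *ℚ 1/ b *ℚ 1ℚ          ≡⟨ cong (a *ℚ 1/ b *ℚ_) (ℚ.*-inverseʳ d) ⟨
  a *ℚ 1/ b *ℚ (d *ℚ 1/ d) ≡⟨ interchange a (1/ b) d (1/ d) ⟩
  a *ℚ d *ℚ (1/ b *ℚ 1/ d) ≡⟨ cong (_*ℚ (1/ b *ℚ 1/ d)) ad≡cb ⟩
  c *ℚ b *ℚ (1/ b *ℚ 1/ d) ≡⟨ rotate c b (1/ b) (1/ d) ⟩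
  c *ℚ 1/ d *ℚ (b *ℚ 1/ b) ≡⟨ cong (c *ℚ 1/ d *ℚ_) (ℚ.*-inverseʳ b) ⟩
  c *ℚ 1/ d *ℚ 1ℚ          ≡⟨ ℚ.*-identityʳ (c *ℚ 1/ d) ⟩
  c *ℚ 1/ d                ∎
  where
  open ≡-Reasoning
  open +-*-Solver
  interchange : ∀ u v w x → u *ℚ v *ℚ (w *ℚ x) ≡ u *ℚ w *ℚ (v *ℚ x)
  interchange = solve 4 (λ u v w x → u :* v :* (w :* x) := u :* w :* (v :* x)) refl
  rotate : ∀ u v w x → u *ℚ v *ℚ (w *ℚ x) ≡ u *ℚ x *ℚ (v *ℚ w)
  rotate = solve 4 (λ u v w x → u :* v :* (w :* x) := u :* x :* (v :* w)) refl

condℚ-cross : ∀ a b c d → b ≢ 0ℚ → d ≢ 0ℚ → a *ℚ d ≡ c *ℚ b → condℚ a b ≡ condℚ c d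
condℚ-cross a b c d b≢0 d≢0 ad≡cb =
  trans (condℚ≡÷ a b b≢0)
        (trans (÷-cross a b c d {{ℚ.≢-nonZero b≢0}} {{ℚ.≢-nonZero d≢0}} ad≡cb) (sym (condℚ≡÷ c d d≢0)))

condℚ-frac : ∀ a b c d N r → Positive r → frac b N ≢ 0ℚ → NonZero d → a * d ≡ c * b →
             condℚ (frac a N) (frac b N) ≡ condℚ (frac c 1 *ℚ r) (frac d 1 *ℚ r)
condℚ-frac a b c d zero    r r>0 b≢0 d≢0 ad≡cb = ⊥-elim (b≢0 refl)
condℚ-frac a b c d (suc N) r r>0 b≢0 d≢0 ad≡cb = condℚ-cross _ _ _ _ b≢0 dr≢0 (begin
  frac a (suc N) *ℚ (frac d 1 *ℚ r) ≡⟨ ℚ.*-assoc (frac a (suc N)) _ r ⟨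
  frac a (suc N) *ℚ frac d 1 *ℚ r   ≡⟨ cong (_*ℚ r) (frac-*₁ a d) ⟩
  frac (a * d) (suc N) *ℚ r         ≡⟨ cong (λ z → frac z (suc N) *ℚ r) ad≡cb ⟩
  frac (c * b) (suc N) *ℚ r         ≡⟨ cong (λ z → frac z (suc N) *ℚ r) (*-comm c b) ⟩
  frac (b * c) (suc N) *ℚ r         ≡⟨ cong (_*ℚ r) (frac-*₁ b c) ⟨
  frac b (suc N) *ℚ frac c 1 *ℚ r   ≡⟨ ℚ.*-assoc (frac b (suc N)) _ r ⟩
  frac b (suc N) *ℚ (frac c 1 *ℚ r) ≡⟨ ℚ.*-comm (frac b (suc N)) _ ⟩
  frac c 1 *ℚ r *ℚ frac b (suc N)   ∎)
  where
  open ≡-Reasoning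
  frac-*₁ : ∀ u v → frac u (suc N) *ℚ frac v 1 ≡ frac (u * v) (suc N)
  frac-*₁ u v = trans (frac-* u N v 0) (cong (frac (u * v)) (*-identityʳ (suc N)))
  dr≢0 : frac d 1 *ℚ r ≢ 0ℚ
  dr≢0 = pos⇒≢0 (frac d 1 *ℚ r) (ℚ.pos*pos⇒pos (frac d 1) {{frac-pos d 0 d≢0}} r {{r>0}})

binomialFactor-pos : ∀ n k Δ → k ≤ n → Positive (frac k n ^ℚ (k * Δ) *ℚ (1ℚ - frac k n) ^ℚ ((n ∸ k) * Δ))
binomialFactor-pos n k Δ k≤n =
  ℚ.pos*pos⇒pos (frac k n ^ℚ (k * Δ)) {{^ℚ-pos _ (k * Δ) (λ kΔ≢0 → frac-k/n-pos k n k≤n (m*n≢0⇒m≢0 k {{kΔ≢0}}))}}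
                ((1ℚ - frac k n) ^ℚ ((n ∸ k) * Δ)) {{^ℚ-pos _ ((n ∸ k) * Δ) (λ tΔ≢0 → 1-frac-k/n-pos k n (m*n≢0⇒m≢0 (n ∸ k) {{tΔ≢0}}))}}

module _ (n m Δ k : ℕ) (g y : Vec ℕ m) where

  count-Γ≡g∧Y≡y : count (λ ω → (degreeVec (Sample.graph ω) ≟ᵛ g) ∧ (Yvec ω ≟ᵛ y)) (allSamples n m Δ k)
                  ≡ length (allSigmas n k) * jointCount (k * Δ) ((n ∸ k) * Δ) g y
  count-Γ≡g∧Y≡y = trans (count-Yvec-degreeVec n m Δ k (λ a d → (d ≟ᵛ g) ∧ (a ≟ᵛ y)))
                        (cong (length (allSigmas n k) *_) (wordPairs-Γ≡g∧Y≡y (k * Δ) ((n ∸ k) * Δ) g y))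

  count-Γ≡g : count (λ ω → degreeVec (Sample.graph ω) ≟ᵛ g) (allSamples n m Δ k)
              ≡ length (allSigmas n k) * multinomial (k * Δ + (n ∸ k) * Δ) g
  count-Γ≡g = trans (count-Yvec-degreeVec n m Δ k (λ _ d → d ≟ᵛ g))
                    (cong (length (allSigmas n k) *_) (wordPairs-Γ≡g (k * Δ) ((n ∸ k) * Δ) g))

  P[Γ≡g]≢0⇒multinomial≢0 : probGS n m Δ k (λ ω → degreeVec (Sample.graph ω) ≟ᵛ g) ≢ 0ℚ →
                           multinomial (k * Δ + (n ∸ k) * Δ) g ≢ 0
  P[Γ≡g]≢0⇒multinomial≢0 P≢0 M≡0 = P≢0 (trans (cong (λ c → frac c (length (allSamples n m Δ k))) B≡0)
                                              (frac-zero (length (allSamples n m Δ k))))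
    where
    B≡0 : count (λ ω → degreeVec (Sample.graph ω) ≟ᵛ g) (allSamples n m Δ k) ≡ 0
    B≡0 = trans count-Γ≡g (trans (cong (length (allSigmas n k) *_) M≡0) (*-zeroʳ (length (allSigmas n k))))

  count-cross-multiplication : vsum g ≡ k * Δ + (n ∸ k) * Δ →
    count (λ ω → (degreeVec (Sample.graph ω) ≟ᵛ g) ∧ (Yvec ω ≟ᵛ y)) (allSamples n m Δ k) * (∑[ x ← box g ] binomialWeight (k * Δ) g x)
    ≡ (∑[ x ← box g ] (𝟙 ((x ≟ᵛ y) ∧ eventE k Δ x) * ∏C g x)) * count (λ ω → degreeVec (Sample.graph ω) ≟ᵛ g) (allSamples n m Δ k)
  count-cross-multiplication vsum-g = begin
    A * S                                         ≡⟨ cong (_* S) count-Γ≡g∧Y≡y ⟩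
    Nσ * jointCount s t g y * S                   ≡⟨ *-assoc Nσ _ S ⟩
    Nσ * (jointCount s t g y * S)                 ≡⟨ cong (Nσ *_) (jointCount-*-∑-box s t g vsum-g y) ⟩
    Nσ * (𝟙 (y ≤ᵇᵛ g) * binomialWeight s g y * M) ≡⟨ *-left-comm Nσ (𝟙 (y ≤ᵇᵛ g) * binomialWeight s g y) M ⟩
    𝟙 (y ≤ᵇᵛ g) * binomialWeight s g y * (Nσ * M) ≡⟨ cong₂ _*_ (∑-box-X≡y∧E s t g y) count-Γ≡g ⟨
    Nₓ * B                                        ∎
    where
    open ≡-Reasoning
    s t Nσ M A B Nₓ S : ℕ
    s  = k * Δ
    t  = (n ∸ k) * Δ
    Nσ = length (allSigmas n k)
    M  = multinomial (s + t) g
    A  = count (λ ω → (degreeVec (Sample.graph ω) ≟ᵛ g) ∧ (Yvec ω ≟ᵛ y)) (allSamples n m Δ k)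
    B  = count (λ ω → degreeVec (Sample.graph ω) ≟ᵛ g) (allSamples n m Δ k)
    Nₓ = ∑[ x ← box g ] (𝟙 ((x ≟ᵛ y) ∧ eventE k Δ x) * ∏C g x)
    S  = ∑[ x ← box g ] binomialWeight s g x

lemmaB2 : (n m Δ k : ℕ) → k ≤ n → (g y : Vec ℕ m) →
    probGS n m Δ k (λ ω → degreeVec (Sample.graph ω) ≟ᵛ g) ≢ 0ℚ →
    condℚ (probGS n m Δ k (λ ω → (degreeVec (Sample.graph ω) ≟ᵛ g) ∧ (Yvec ω ≟ᵛ y)))
          (probGS n m Δ k (λ ω → degreeVec (Sample.graph ω) ≟ᵛ g))
    ≡ condℚ (probX g (frac k n) (λ x → (x ≟ᵛ y) ∧ eventE k Δ x))
            (probX g (frac k n) (eventE k Δ))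
lemmaB2 n m Δ k k≤n g y P≢0 =
  trans (condℚ-frac A B Nₓ S (length (allSamples n m Δ k)) r (binomialFactor-pos n k Δ k≤n) P≢0
                    (∑-box-binomialWeight-nonZero s t g vsum-g M≢0) (count-cross-multiplication n m Δ k g y vsum-g))
        (sym (cong₂ condℚ (probX≡ g (frac k n) s t _ vsum-g (λ x e → ≡ᵇ-true⇒≡ _ _ (∧-conicalʳ (x ≟ᵛ y) _ e)))
                          (probX≡ g (frac k n) s t _ vsum-g (λ x → ≡ᵇ-true⇒≡ _ _))))
  where
  s t A B Nₓ S : ℕ
  s  = k * Δ
  t  = (n ∸ k) * Δ
  A  = count (λ ω → (degreeVec (Sample.graph ω) ≟ᵛ g) ∧ (Yvec ω ≟ᵛ y)) (allSamples n m Δ k)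
  B  = count (λ ω → degreeVec (Sample.graph ω) ≟ᵛ g) (allSamples n m Δ k)
  Nₓ = ∑[ x ← box g ] (𝟙 ((x ≟ᵛ y) ∧ eventE k Δ x) * ∏C g x)
  S  = ∑[ x ← box g ] binomialWeight s g x
  r : ℚ
  r = frac k n ^ℚ s *ℚ (1ℚ - frac k n) ^ℚ t
  M≢0 : multinomial (s + t) g ≢ 0
  M≢0 = P[Γ≡g]≢0⇒multinomial≢0 n m Δ k g y P≢0
  vsum-g : vsum g ≡ s + t
  vsum-g = multinomial≢0⇒vsum≡ (s + t) g M≢0
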